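{- Let $q$ be a prime power, $N\ge1$, and fix a basis $\{e_1,\dots,e_N\}$ of $\mathbb{F}_q^N$. Let $x,y\in\{0,1\}^N$ be at Hamming distance $1$, with $x_k=1$ and $y_k=0$. Let $\mathcal{V}\subseteq\mathbb{F}_q^N$ be any subspace such that the diagonal of $\tau(\mathcal{V})$ is $x$. Then the number $n_k(x)$ of subspaces $\mathcal{U}$ covered by $\mathcal{V}$ (i.e. $\mathcal{U}\subset\mathcal{V}$, $\dim\mathcal{V}=\dim\mathcal{U}+1$) such that the diagonal of $\tau(\mathcal{U})$ is $y$ equals $$n_k(x)=q^{\sum_{j=k+1}^N x_j}.$$
   Context: For a subspace $\mathcal{V}\subseteq\mathbb{F}_q^N$, $\tau(\mathcal{V})$ denotes the unique upper triangular $N\times N$ matrix $\boldsymbol{v}=(\boldsymbol{v}_{ij})$ with entries in $\mathbb{F}_q$ such that: its columns $\boldsymbol{v}_j=\sum_i \boldsymbol{v}_{ij}e_i$ span $\mathcal{V}$; its diagonal entries satisfy $\boldsymbol{v}_{ii}\in\{0,1\}$; and for $i\neq j$, $\boldsymbol{v}_{ij}\neq0$ implies $\boldsymbol{v}_{ii}=0$ and $\boldsymbol{v}_{jj}=1$. The diagonal of $\tau(\mathcal{V})$ means the sequence $(\boldsymbol{v}_{11},\dots,\boldsymbol{v}_{NN})\in\{0,1\}^N$. -}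

module Defs where

open import Level using (0ℓ)
open import Data.Nat using (ℕ; zero; suc; _+_; _<ᵇ_)
open import Data.Bool using (Bool; true; false; if_then_else_; _∧_; _xor_)
open import Data.Fin using (Fin; toℕ)
open import Data.Vec using (Vec; []; _∷_; lookup; tabulate; zipWith; replicate; foldr)
import Data.Vec
import Data.Nat
open import Data.Product using (Σ; ∃; _×_; _,_)
open import Data.Sum using (_⊎_)
open import Data.List using (List; length)
open import Data.List.Relation.Unary.All using (All)
open import Data.List.Relation.Unary.Any using (Any)
open import Data.List.Relation.Unary.AllPairs using (AllPairs)
open import Relation.Nullary using (¬_)
open import Relation.Binary.PropositionalEquality using (_≡_; _≢_)
import Algebra.Structures as AS
open import Function.Bundles using (_↔_)

-- Every such field has prime-power order, and for every prime power q one exists,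
-- so "F_q" is modelled as an arbitrary finite field of cardinality q.
record FiniteField (q : ℕ) : Set₁ where
  infixl 6 _+F_
  infixl 7 _*F_
  field
    Carrier : Set
    _+F_ _*F_ : Carrier → Carrier → Carrier
    -F_ : Carrier → Carrier
    0F 1F : Carrier
    isCommutativeRing : AS.IsCommutativeRing {A = Carrier} _≡_ _+F_ _*F_ -F_ 0F 1F
    0≢1 : 0F ≢ 1F
    inverse : ∀ x → x ≢ 0F → ∃ λ y → x *F y ≡ 1F
    enumeration : Fin q ↔ Carrier

module Linear {q : ℕ} (K : FiniteField q) (N : ℕ) where
  open FiniteField K

  -- vectors of F_q^N, in coordinates w.r.t. the fixed basis e_1..e_N
  Vector : Set
  Vector = Vec Carrier N

  zeroV : Vector
  zeroV = replicate N 0F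

  _+V_ : Vector → Vector → Vector
  _+V_ = zipWith _+F_

  _·V_ : Carrier → Vector → Vector
  c ·V v = Data.Vec.map (c *F_) v

  linComb : ∀ {m} → Vec Carrier m → Vec Vector m → Vector
  linComb [] [] = zeroV
  linComb (c ∷ cs) (v ∷ vs) = (c ·V v) +V linComb cs vs

  InSpan : ∀ {m} → Vec Vector m → Vector → Set
  InSpan vs w = Σ (Vec Carrier _) λ cs → linComb cs vs ≡ w

  LinIndep : ∀ {m} → Vec Vector m → Set
  LinIndep vs = ∀ cs → linComb cs vs ≡ zeroV → ∀ i → lookup cs i ≡ 0F

  record Subspace : Set₁ where
    field
      member : Vector → Set
      zero∈ : member zeroV
      +∈ : ∀ {v w} → member v → member w → member (v +V w)
      ·∈ : ∀ c {v} → member v → member (c ·V v)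
  open Subspace public

  _⊆S_ : Subspace → Subspace → Set
  U ⊆S V = ∀ v → member U v → member V v

  _≐_ : Subspace → Subspace → Set
  U ≐ V = U ⊆S V × V ⊆S U

  HasDim : Subspace → ℕ → Set
  HasDim U d = Σ (Vec Vector d) λ bs →
    LinIndep bs × (∀ i → member U (lookup bs i)) × (∀ v → member U v → InSpan bs v)

  Covers : Subspace → Subspace → Set
  Covers V U = U ⊆S V × Σ ℕ λ d → HasDim U d × HasDim V (suc d)

  Matrix : Set
  Matrix = Fin N → Fin N → Carrier

  columns : Matrix → Vec Vector N
  columns v = tabulate λ j → tabulate λ i → v i j

  -- v is τ(V) (the paper's defining properties of τ(V))
  record IsTau (V : Subspace) (v : Matrix) : Set where
    field
      upper : ∀ i j → toℕ j Data.Nat.< toℕ i → v i j ≡ 0F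
      spans : ∀ w → (member V w → InSpan (columns v) w) × (InSpan (columns v) w → member V w)
      diag01 : ∀ i → v i i ≡ 0F ⊎ v i i ≡ 1F
      offDiag : ∀ i j → i ≢ j → v i j ≢ 0F → (v i i ≡ 0F × v j j ≡ 1F)

  bit : Bool → Carrier
  bit true = 1F
  bit false = 0F

  TauDiag : Subspace → Vec Bool N → Set
  TauDiag V x = Σ Matrix λ v → IsTau V v × (∀ i → v i i ≡ bit (lookup x i))

  -- number of subspaces satisfying P equals n (subspaces counted up to equality as sets)
  CountIs : (Subspace → Set) → ℕ → Set₁
  CountIs P n = Σ (List Subspace) λ L →
    length L ≡ n × All P L × AllPairs (λ U W → ¬ (U ≐ W)) L
      × (∀ U → P U → Any (λ W → U ≐ W) L)

hamming : ∀ {N} → Vec Bool N → Vec Bool N → ℕ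
hamming [] [] = 0
hamming (a ∷ as) (b ∷ bs) = (if a xor b then 1 else 0) + hamming as bs

sumAfter : ∀ {N} → Fin N → Vec Bool N → ℕ
sumAfter {N} k x = foldr _ _+_ 0 (tabulate {n = N} λ j →
  if (toℕ k <ᵇ toℕ j) ∧ lookup x j then 1 else 0)

-- Let v = τ(V). Since x_k = 1, column k of v is a pivot column, and the
-- positions j > k with x_j = 1 are the pivot columns of v that may still
-- have a nonzero entry in row k. For a vector a supported on these free
-- positions, add a_j times column k of v to every other column j and then
-- replace column k by 0: the result is again in reduced form, with diagonal
-- y, so it is τ of the hyperplane of V it spans. Conversely, if U ⊂ V and
-- τ(U) = u has diagonal y, expanding the columns of u in the pivot columns of
-- v shows that u arises in this way from a = row k of u, and a is recovered
-- from U since τ is unique. Hence these U correspond bijectively to F_q^m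
-- with m = Σ_{j>k} x_j.

module Submission where

open import Defs
open import Level using (0ℓ)
open import Algebra.Bundles using (CommutativeRing)
open import Data.Bool using (Bool; true; false; if_then_else_; _∧_; T)
open import Data.Bool.Properties using (T-≡; T-∧)
open import Data.Empty using (⊥-elim)
open import Data.Fin using (Fin; zero; suc; toℕ; _≟_; punchIn; punchOut)
import Data.Fin as Fin
open import Data.Fin.Properties
  using (inj⇒≟; suc-injective; toℕ-injective; punchInᵢ≢i; punchIn-punchOut; punchIn-injective)
open import Data.List using (List; length; cartesianProductWith; [_])
import Data.List as List
import Data.List.Properties as ListP
open import Data.List.Membership.Propositional using (_∈_)
open import Data.List.Membership.Propositional.Properties using (∈-tabulate⁺)
import Data.List.Relation.Unary.All as All
import Data.List.Relation.Unary.All.Properties as AllP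
open import Data.List.Relation.Unary.AllPairs using ([]; _∷_)
import Data.List.Relation.Unary.AllPairs as AllPairs
import Data.List.Relation.Unary.AllPairs.Properties as AllPairsP
open import Data.List.Relation.Unary.Any using (Any; here)
import Data.List.Relation.Unary.Any as Any
import Data.List.Relation.Unary.Any.Properties as AnyP
open import Data.List.Relation.Unary.Unique.Propositional using (Unique)
import Data.List.Relation.Unary.Unique.Propositional.Properties as UniqueP
open import Data.Nat using (ℕ; zero; suc; _+_; _*_; _^_; _<ᵇ_; _<_)
import Data.Nat.Properties as NatP
open import Data.Product using (_×_; _,_; proj₁; proj₂; ∃)
open import Data.Sum using (_⊎_; inj₁; inj₂)
open import Data.Vec using (Vec; []; _∷_; lookup; tabulate; foldr; replicate; zipWith; _[_]≔_)
import Data.Vec as Vec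
import Data.Vec.Properties as VecP
open import Function using (_∘_)
open import Function.Bundles using (Inverse; Injection; Equivalence)
open import Function.Properties.Inverse using (↔⇒↣; ↔-sym)
open import Relation.Binary.Definitions using (DecidableEquality; tri<; tri≈; tri>)
open import Relation.Binary.PropositionalEquality
  using (_≡_; _≢_; refl; sym; trans; cong; cong₂; subst; module ≡-Reasoning)
open import Relation.Nullary using (yes; no; ¬_)

lookup-ext : ∀ {A : Set} {n} {u v : Vec A n} → (∀ i → lookup u i ≡ lookup v i) → u ≡ v
lookup-ext {u = []} {[]} _ = refl
lookup-ext {u = a ∷ u} {b ∷ v} eq = cong₂ _∷_ (eq zero) (lookup-ext (eq ∘ suc))

countTrue : ∀ {n} → Vec Bool n → ℕ
countTrue [] = 0
countTrue (true ∷ s) = suc (countTrue s)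
countTrue (false ∷ s) = countTrue s

countTrue-tabulate : ∀ {n} (f : Fin n → Bool) →
  countTrue (tabulate f) ≡ foldr _ _+_ 0 (tabulate (λ j → if f j then 1 else 0))
countTrue-tabulate {zero} f = refl
countTrue-tabulate {suc n} f with f zero
... | true = cong suc (countTrue-tabulate (f ∘ suc))
... | false = countTrue-tabulate (f ∘ suc)

hamming≡0⇒≡ : ∀ {n} (x y : Vec Bool n) → hamming x y ≡ 0 → x ≡ y
hamming≡0⇒≡ [] [] _ = refl
hamming≡0⇒≡ (true ∷ x) (true ∷ y) h = cong (true ∷_) (hamming≡0⇒≡ x y h)
hamming≡0⇒≡ (false ∷ x) (false ∷ y) h = cong (false ∷_) (hamming≡0⇒≡ x y h)

agree-∷ : ∀ {n} {x y : Vec Bool n} {k : Fin n} (a : Bool) →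
  (∀ j → j ≢ k → lookup x j ≡ lookup y j) → ∀ j → j ≢ suc k → lookup (a ∷ x) j ≡ lookup (a ∷ y) j
agree-∷ a agree zero _ = refl
agree-∷ a agree (suc j) j≢k = agree j (j≢k ∘ cong suc)

hamming≡1⇒agree : ∀ {n} (x y : Vec Bool n) (k : Fin n) → hamming x y ≡ 1 →
  lookup x k ≡ true → lookup y k ≡ false → ∀ j → j ≢ k → lookup x j ≡ lookup y j
hamming≡1⇒agree (true ∷ x) (false ∷ y) zero h _ _ zero j≢k = ⊥-elim (j≢k refl)
hamming≡1⇒agree (true ∷ x) (false ∷ y) zero h _ _ (suc j) _ =
  cong (λ z → lookup z j) (hamming≡0⇒≡ x y (NatP.suc-injective h))
hamming≡1⇒agree (true ∷ x) (true ∷ y) (suc k) h xk yk = agree-∷ true (hamming≡1⇒agree x y k h xk yk)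
hamming≡1⇒agree (false ∷ x) (false ∷ y) (suc k) h xk yk = agree-∷ false (hamming≡1⇒agree x y k h xk yk)
hamming≡1⇒agree (true ∷ x) (false ∷ y) (suc k) h xk yk
  with () ← trans (sym xk) (trans (cong (λ z → lookup z k) (hamming≡0⇒≡ x y (NatP.suc-injective h))) yk)
hamming≡1⇒agree (false ∷ x) (true ∷ y) (suc k) h xk yk
  with () ← trans (sym xk) (trans (cong (λ z → lookup z k) (hamming≡0⇒≡ x y (NatP.suc-injective h))) yk)

countTrue-drop : ∀ {n} (x y : Vec Bool n) (k : Fin n) → (∀ j → j ≢ k → lookup x j ≡ lookup y j) →
  lookup x k ≡ true → lookup y k ≡ false → countTrue x ≡ suc (countTrue y)
countTrue-drop (true ∷ x) (false ∷ y) zero agree _ _ =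
  cong (suc ∘ countTrue) (lookup-ext {u = x} {y} (λ j → agree (suc j) (λ ())))
countTrue-drop (true ∷ x) (true ∷ y) (suc k) agree xk yk =
  cong suc (countTrue-drop x y k (λ j j≢k → agree (suc j) (j≢k ∘ suc-injective)) xk yk)
countTrue-drop (false ∷ x) (false ∷ y) (suc k) agree xk yk =
  countTrue-drop x y k (λ j j≢k → agree (suc j) (j≢k ∘ suc-injective)) xk yk
countTrue-drop (true ∷ x) (false ∷ y) (suc k) agree _ _ with () ← agree zero (λ ())
countTrue-drop (false ∷ x) (true ∷ y) (suc k) agree _ _ with () ← agree zero (λ ())

positions : ∀ {n} (s : Vec Bool n) → Vec (Fin n) (countTrue s)
positions [] = []
positions (true ∷ s) = zero ∷ Vec.map suc (positions s)
positions (false ∷ s) = Vec.map suc (positions s)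

lookup-positions : ∀ {n} (s : Vec Bool n) t → lookup s (lookup (positions s) t) ≡ true
lookup-positions (true ∷ s) zero = refl
lookup-positions (true ∷ s) (suc t) rewrite VecP.lookup-map t Fin.suc (positions s) = lookup-positions s t
lookup-positions (false ∷ s) t rewrite VecP.lookup-map t Fin.suc (positions s) = lookup-positions s t

module _ {A : Set} where

  scatter : ∀ {n} (fill : A) (s : Vec Bool n) → Vec A (countTrue s) → Vec A n
  scatter fill [] [] = []
  scatter fill (true ∷ s) (a ∷ c) = a ∷ scatter fill s c
  scatter fill (false ∷ s) c = fill ∷ scatter fill s c

  gather : ∀ {n} (s : Vec Bool n) → Vec A n → Vec A (countTrue s)
  gather s w = Vec.map (lookup w) (positions s)

  lookup-scatter-false : ∀ {n} fill (s : Vec Bool n) c j → lookup s j ≡ false → lookup (scatter fill s c) j ≡ fill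
  lookup-scatter-false fill (true ∷ s) (a ∷ c) (suc j) sj = lookup-scatter-false fill s c j sj
  lookup-scatter-false fill (false ∷ s) c zero _ = refl
  lookup-scatter-false fill (false ∷ s) c (suc j) sj = lookup-scatter-false fill s c j sj

  lookup-scatter-positions : ∀ {n} fill (s : Vec Bool n) c t →
    lookup (scatter fill s c) (lookup (positions s) t) ≡ lookup c t
  lookup-scatter-positions fill (true ∷ s) (a ∷ c) zero = refl
  lookup-scatter-positions fill (true ∷ s) (a ∷ c) (suc t)
    rewrite VecP.lookup-map t Fin.suc (positions s) = lookup-scatter-positions fill s c t
  lookup-scatter-positions fill (false ∷ s) c t
    rewrite VecP.lookup-map t Fin.suc (positions s) = lookup-scatter-positions fill s c t

  lookup-scatter-gather : ∀ {n} fill (s : Vec Bool n) w j → lookup s j ≡ true →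
    lookup (scatter fill s (gather s w)) j ≡ lookup w j
  lookup-scatter-gather fill (true ∷ s) (a ∷ w) zero _ = refl
  lookup-scatter-gather fill (true ∷ s) (a ∷ w) (suc j) sj
    rewrite sym (VecP.map-∘ (lookup (a ∷ w)) Fin.suc (positions s)) = lookup-scatter-gather fill s w j sj
  lookup-scatter-gather fill (false ∷ s) (a ∷ w) (suc j) sj
    rewrite sym (VecP.map-∘ (lookup (a ∷ w)) Fin.suc (positions s)) = lookup-scatter-gather fill s w j sj

  scatter-injective : ∀ {n} fill (s : Vec Bool n) {c c'} → scatter fill s c ≡ scatter fill s c' → c ≡ c'
  scatter-injective fill s {c} {c'} eq = lookup-ext λ t → begin
    lookup c t                                          ≡⟨ lookup-scatter-positions fill s c t ⟨
    lookup (scatter fill s c) (lookup (positions s) t)  ≡⟨ cong (λ w → lookup w (lookup (positions s) t)) eq ⟩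
    lookup (scatter fill s c') (lookup (positions s) t) ≡⟨ lookup-scatter-positions fill s c' t ⟩
    lookup c' t                                         ∎
    where open ≡-Reasoning

  scatter-gather : ∀ {n} fill (s : Vec Bool n) {w} → (∀ j → lookup s j ≡ false → lookup w j ≡ fill) →
    scatter fill s (gather s w) ≡ w
  scatter-gather fill s {w} w≡fill = lookup-ext entry
    where
    entry : ∀ j → lookup (scatter fill s (gather s w)) j ≡ lookup w j
    entry j with lookup s j in sj
    ... | true = lookup-scatter-gather fill s w j sj
    ... | false = trans (lookup-scatter-false fill s _ j sj) (sym (w≡fill j sj))

  vectors : List A → (m : ℕ) → List (Vec A m)
  vectors as zero = [ [] ]
  vectors as (suc m) = cartesianProductWith _∷_ as (vectors as m)

  length-cartesianProductWith : ∀ {B C : Set} (f : A → B → C) xs ys →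
    length (cartesianProductWith f xs ys) ≡ length xs * length ys
  length-cartesianProductWith f List.[] ys = refl
  length-cartesianProductWith f (x List.∷ xs) ys = begin
    length (List.map (f x) ys List.++ cartesianProductWith f xs ys)
      ≡⟨ ListP.length-++ (List.map (f x) ys) ⟩
    length (List.map (f x) ys) + length (cartesianProductWith f xs ys)
      ≡⟨ cong₂ _+_ (ListP.length-map (f x) ys) (length-cartesianProductWith f xs ys) ⟩
    length ys + length xs * length ys ∎
    where open ≡-Reasoning

  length-vectors : ∀ as m → length (vectors as m) ≡ length as ^ m
  length-vectors as zero = refl
  length-vectors as (suc m) =
    trans (length-cartesianProductWith _∷_ as (vectors as m)) (cong (length as *_) (length-vectors as m))

  vectors-unique : ∀ {as} → Unique as → ∀ m → Unique (vectors as m)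
  vectors-unique as! zero = All.[] ∷ []
  vectors-unique as! (suc m) = UniqueP.cartesianProductWith⁺ _∷_ VecP.∷-injective as! (vectors-unique as! m)

  ∈-vectors : ∀ {as} → (∀ a → a ∈ as) → ∀ {m} (c : Vec A m) → c ∈ vectors as m
  ∈-vectors ∈as [] = here refl
  ∈-vectors ∈as (a ∷ c) =
    AnyP.cartesianProductWith⁺ _∷_ (λ { refl refl → refl }) (∈as a) (∈-vectors ∈as c)

module _ {q : ℕ} (K : FiniteField q) where
  open FiniteField K

  commutativeRing : CommutativeRing 0ℓ 0ℓ
  commutativeRing = record { isCommutativeRing = isCommutativeRing }

  open CommutativeRing commutativeRing
    using (+-identityˡ; +-identityʳ; *-identityˡ; *-identityʳ; zeroˡ; zeroʳ; distribʳ; *-assoc)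
  open import Algebra.Properties.Semiring.Sum (CommutativeRing.semiring commutativeRing)
    using (sum; sum-cong-≗; sum-replicate-zero; sum-remove; ∑-distrib-+; *-distribˡ-sum)

  _≟F_ : DecidableEquality Carrier
  _≟F_ = inj⇒≟ (↔⇒↣ (↔-sym enumeration))

  elements : List Carrier
  elements = List.tabulate (Inverse.to enumeration)

  length-elements : length elements ≡ q
  length-elements = ListP.length-tabulate (Inverse.to enumeration)

  elements-unique : Unique elements
  elements-unique = UniqueP.tabulate⁺ (Injection.injective (↔⇒↣ enumeration))

  ∈-elements : ∀ a → a ∈ elements
  ∈-elements a = subst (_∈ elements) (Inverse.strictlyInverseˡ enumeration a) (∈-tabulate⁺ _)

  zeroˡ′ : ∀ {a} b → a ≡ 0F → a *F b ≡ 0F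
  zeroˡ′ b refl = zeroˡ b

  zeroʳ′ : ∀ a {b} → b ≡ 0F → a *F b ≡ 0F
  zeroʳ′ a refl = zeroʳ a

  bit01 : ∀ {N} b → Linear.bit K N b ≡ 0F ⊎ Linear.bit K N b ≡ 1F
  bit01 false = inj₁ refl
  bit01 true = inj₂ refl

  sum-zero : ∀ {n} (f : Fin n → Carrier) → (∀ i → f i ≡ 0F) → sum f ≡ 0F
  sum-zero {n} f f≡0 = trans (sum-cong-≗ f≡0) (sum-replicate-zero n)

  sum-single : ∀ {n} (f : Fin n → Carrier) a → (∀ i → i ≢ a → f i ≡ 0F) → sum f ≡ f a
  sum-single {suc n} f a vanish = begin
    sum f                       ≡⟨ sum-remove f ⟩
    f a +F sum (f ∘ punchIn a)
      ≡⟨ cong (f a +F_) (sum-zero (f ∘ punchIn a) (λ i → vanish _ (punchInᵢ≢i a i))) ⟩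
    f a +F 0F                   ≡⟨ +-identityʳ (f a) ⟩
    f a                         ∎
    where open ≡-Reasoning

  sum-pair : ∀ {n} (f : Fin n → Carrier) {a b} → a ≢ b → (∀ i → i ≢ a → i ≢ b → f i ≡ 0F) →
    sum f ≡ f a +F f b
  sum-pair {suc n} f {a} {b} a≢b vanish = begin
    sum f                       ≡⟨ sum-remove f ⟩
    f a +F sum (f ∘ punchIn a)  ≡⟨ cong (f a +F_) (sum-single (f ∘ punchIn a) (punchOut a≢b) vanishOutside) ⟩
    f a +F f (punchIn a (punchOut a≢b)) ≡⟨ cong (λ i → f a +F f i) (punchIn-punchOut a≢b) ⟩
    f a +F f b                  ∎
    where
    open ≡-Reasoning
    vanishOutside : ∀ i → i ≢ punchOut a≢b → f (punchIn a i) ≡ 0F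
    vanishOutside i i≢ = vanish _ (punchInᵢ≢i a i) λ eq →
      i≢ (punchIn-injective a i _ (trans eq (sym (punchIn-punchOut a≢b))))

  sum-positions : ∀ {n} (s : Vec Bool n) (f : Fin n → Carrier) → (∀ j → lookup s j ≡ false → f j ≡ 0F) →
    sum f ≡ sum (f ∘ lookup (positions s))
  sum-positions [] f _ = refl
  sum-positions (true ∷ s) f vanish = cong (f zero +F_) (trans
    (sum-positions s (f ∘ suc) (vanish ∘ suc))
    (sum-cong-≗ (λ t → cong f (sym (VecP.lookup-map t Fin.suc (positions s))))))
  sum-positions (false ∷ s) f vanish = begin
    f zero +F sum (f ∘ suc)  ≡⟨ cong (_+F sum (f ∘ suc)) (vanish zero refl) ⟩
    0F +F sum (f ∘ suc)      ≡⟨ +-identityˡ _ ⟩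
    sum (f ∘ suc)            ≡⟨ sum-positions s (f ∘ suc) (vanish ∘ suc) ⟩
    sum (f ∘ suc ∘ lookup (positions s))
      ≡⟨ sum-cong-≗ (λ t → cong f (sym (VecP.lookup-map t Fin.suc (positions s)))) ⟩
    sum (f ∘ lookup (Vec.map suc (positions s))) ∎
    where open ≡-Reasoning

  module _ (N : ℕ) where
    open Linear K N

    lookup-linComb : ∀ {m} (cs : Vec Carrier m) (vs : Vec Vector m) i →
      lookup (linComb cs vs) i ≡ sum (λ l → lookup cs l *F lookup (lookup vs l) i)
    lookup-linComb [] [] i = VecP.lookup-replicate i 0F
    lookup-linComb (c ∷ cs) (v ∷ vs) i = trans (VecP.lookup-zipWith _+F_ i (c ·V v) (linComb cs vs))
      (cong₂ _+F_ (VecP.lookup-map i (c *F_) v) (lookup-linComb cs vs i))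

    linComb-zero : ∀ {m} (vs : Vec Vector m) → linComb (replicate m 0F) vs ≡ zeroV
    linComb-zero {m} vs = lookup-ext λ i → begin
      lookup (linComb (replicate m 0F) vs) i  ≡⟨ lookup-linComb (replicate m 0F) vs i ⟩
      sum (λ l → lookup (replicate m 0F) l *F lookup (lookup vs l) i)
        ≡⟨ sum-zero (λ l → lookup (replicate m 0F) l *F lookup (lookup vs l) i)
             (λ l → zeroˡ′ _ (VecP.lookup-replicate l 0F)) ⟩
      0F                                      ≡⟨ VecP.lookup-replicate i 0F ⟨
      lookup zeroV i                          ∎
      where open ≡-Reasoning

    linComb-+ : ∀ {m} (cs ds : Vec Carrier m) (vs : Vec Vector m) →
      linComb (zipWith _+F_ cs ds) vs ≡ linComb cs vs +V linComb ds vs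
    linComb-+ cs ds vs = lookup-ext λ i → begin
      lookup (linComb (zipWith _+F_ cs ds) vs) i  ≡⟨ lookup-linComb (zipWith _+F_ cs ds) vs i ⟩
      sum (λ l → lookup (zipWith _+F_ cs ds) l *F lookup (lookup vs l) i)
        ≡⟨ sum-cong-≗ (λ l → trans (cong (_*F _) (VecP.lookup-zipWith _+F_ l cs ds)) (distribʳ _ _ _)) ⟩
      sum (λ l → lookup cs l *F lookup (lookup vs l) i +F lookup ds l *F lookup (lookup vs l) i)
        ≡⟨ ∑-distrib-+ (λ l → lookup cs l *F lookup (lookup vs l) i)
                       (λ l → lookup ds l *F lookup (lookup vs l) i) ⟩
      sum (λ l → lookup cs l *F lookup (lookup vs l) i) +F sum (λ l → lookup ds l *F lookup (lookup vs l) i)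
        ≡⟨ cong₂ _+F_ (lookup-linComb cs vs i) (lookup-linComb ds vs i) ⟨
      lookup (linComb cs vs) i +F lookup (linComb ds vs) i
        ≡⟨ VecP.lookup-zipWith _+F_ i (linComb cs vs) (linComb ds vs) ⟨
      lookup (linComb cs vs +V linComb ds vs) i  ∎
      where open ≡-Reasoning

    linComb-· : ∀ {m} c (cs : Vec Carrier m) (vs : Vec Vector m) →
      linComb (Vec.map (c *F_) cs) vs ≡ c ·V linComb cs vs
    linComb-· c cs vs = lookup-ext λ i → begin
      lookup (linComb (Vec.map (c *F_) cs) vs) i  ≡⟨ lookup-linComb (Vec.map (c *F_) cs) vs i ⟩
      sum (λ l → lookup (Vec.map (c *F_) cs) l *F lookup (lookup vs l) i)
        ≡⟨ sum-cong-≗ (λ l → trans (cong (_*F _) (VecP.lookup-map l (c *F_) cs)) (*-assoc _ _ _)) ⟩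
      sum (λ l → c *F (lookup cs l *F lookup (lookup vs l) i))
        ≡⟨ *-distribˡ-sum c (λ l → lookup cs l *F lookup (lookup vs l) i) ⟨
      c *F sum (λ l → lookup cs l *F lookup (lookup vs l) i)    ≡⟨ cong (c *F_) (lookup-linComb cs vs i) ⟨
      c *F lookup (linComb cs vs) i                ≡⟨ VecP.lookup-map i (c *F_) (linComb cs vs) ⟨
      lookup (c ·V linComb cs vs) i                ∎
      where open ≡-Reasoning

    span : ∀ {m} → Vec Vector m → Subspace
    span vs = record
      { member = InSpan vs
      ; zero∈ = replicate _ 0F , linComb-zero vs
      ; +∈ = λ { (cs , refl) (ds , refl) → zipWith _+F_ cs ds , linComb-+ cs ds vs }
      ; ·∈ = λ { c (cs , refl) → Vec.map (c *F_) cs , linComb-· c cs vs }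
      }

    linComb∈ : ∀ (U : Subspace) {m} (cs : Vec Carrier m) {vs : Vec Vector m} →
      (∀ t → member U (lookup vs t)) → member U (linComb cs vs)
    linComb∈ U [] {[]} _ = zero∈ U
    linComb∈ U (c ∷ cs) {v ∷ vs} vs∈U = +∈ U (·∈ U c (vs∈U zero)) (linComb∈ U cs (vs∈U ∘ suc))

    linComb-gather : ∀ {n} (z : Vec Bool n) cs (vs : Vec Vector n) →
      linComb cs (gather z vs) ≡ linComb (scatter 0F z cs) vs
    linComb-gather z cs vs = lookup-ext entry
      where
      entry : ∀ i → lookup (linComb cs (gather z vs)) i ≡ lookup (linComb (scatter 0F z cs) vs) i
      entry i = begin
        lookup (linComb cs (gather z vs)) i
          ≡⟨ lookup-linComb cs (gather z vs) i ⟩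
        sum (λ t → lookup cs t *F lookup (lookup (gather z vs) t) i)
          ≡⟨ sum-cong-≗ (λ t → cong₂ (λ c u → c *F lookup u i)
               (sym (lookup-scatter-positions 0F z cs t)) (VecP.lookup-map t (lookup vs) (positions z))) ⟩
        sum (λ t → f (lookup (positions z) t))
          ≡⟨ sum-positions z f (λ l zl≡false → zeroˡ′ _ (lookup-scatter-false 0F z cs l zl≡false)) ⟨
        sum f
          ≡⟨ lookup-linComb (scatter 0F z cs) vs i ⟨
        lookup (linComb (scatter 0F z cs) vs) i ∎
        where
        open ≡-Reasoning
        f = λ l → lookup (scatter 0F z cs) l *F lookup (lookup vs l) i

    lookup-columns : ∀ (m : Matrix) j i → lookup (lookup (columns m) j) i ≡ m i j
    lookup-columns m j i =
      trans (cong (λ col → lookup col i) (VecP.lookup∘tabulate _ j)) (VecP.lookup∘tabulate _ i)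

    lookup-linComb-columns : ∀ cs (m : Matrix) i →
      lookup (linComb cs (columns m)) i ≡ sum (λ l → lookup cs l *F m i l)
    lookup-linComb-columns cs m i =
      trans (lookup-linComb cs (columns m) i) (sum-cong-≗ (λ l → cong (lookup cs l *F_) (lookup-columns m l i)))

    column∈span : ∀ (m : Matrix) j → InSpan (columns m) (lookup (columns m) j)
    column∈span m j = unit , lookup-ext entry
      where
      unit = replicate N 0F [ j ]≔ 1F
      offUnit : ∀ i l → l ≢ j → lookup unit l *F m i l ≡ 0F
      offUnit i l l≢j =
        zeroˡ′ _ (trans (VecP.lookup∘update′ l≢j (replicate N 0F) 1F) (VecP.lookup-replicate l 0F))
      entry : ∀ i → lookup (linComb unit (columns m)) i ≡ lookup (lookup (columns m) j) i
      entry i = begin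
        lookup (linComb unit (columns m)) i  ≡⟨ lookup-linComb-columns unit m i ⟩
        sum (λ l → lookup unit l *F m i l)   ≡⟨ sum-single (λ l → lookup unit l *F m i l) j (offUnit i) ⟩
        lookup unit j *F m i j               ≡⟨ cong (_*F m i j) (VecP.lookup∘update j (replicate N 0F) 1F) ⟩
        1F *F m i j                          ≡⟨ *-identityˡ _ ⟩
        m i j                                ≡⟨ lookup-columns m j i ⟨
        lookup (lookup (columns m) j) i      ∎
        where open ≡-Reasoning

    module _ {V : Subspace} {v : Matrix} (τV : IsTau V v) where
      open IsTau τV

      pivotRow-vanishes : ∀ {i j} → v i i ≡ 1F → i ≢ j → v i j ≡ 0F
      pivotRow-vanishes {i} {j} vii≡1 i≢j with v i j ≟F 0F
      ... | yes vij≡0 = vij≡0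
      ... | no vij≢0 = ⊥-elim (0≢1 (trans (sym (proj₁ (offDiag i j i≢j vij≢0))) vii≡1))

      column-vanishes : ∀ {i j} → v j j ≡ 0F → v i j ≡ 0F
      column-vanishes {i} {j} vjj≡0 with i ≟ j | v i j ≟F 0F
      ... | yes refl | _ = vjj≡0
      ... | no _ | yes vij≡0 = vij≡0
      ... | no i≢j | no vij≢0 = ⊥-elim (0≢1 (trans (sym vjj≡0) (proj₂ (offDiag i j i≢j vij≢0))))

      column∈ : ∀ j → member V (lookup (columns v) j)
      column∈ j = proj₂ (spans _) (column∈span v j)

      linComb-at-pivot : ∀ cs {l} → v l l ≡ 1F → lookup (linComb cs (columns v)) l ≡ lookup cs l
      linComb-at-pivot cs {l} vll≡1 = begin
        lookup (linComb cs (columns v)) l  ≡⟨ lookup-linComb-columns cs v l ⟩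
        sum (λ t → lookup cs t *F v l t)   ≡⟨ sum-single (λ t → lookup cs t *F v l t) l offPivot ⟩
        lookup cs l *F v l l               ≡⟨ cong (lookup cs l *F_) vll≡1 ⟩
        lookup cs l *F 1F                  ≡⟨ *-identityʳ _ ⟩
        lookup cs l                        ∎
        where
        open ≡-Reasoning
        offPivot : ∀ t → t ≢ l → lookup cs t *F v l t ≡ 0F
        offPivot t t≢l = zeroʳ′ _ (pivotRow-vanishes vll≡1 (t≢l ∘ sym))

      -- The factor v l l restricts the sum to pivots: w = Σ_{pivot l} w_l · (column l of τ(V)).
      pivot-expansion : ∀ {w} → member V w → ∀ i → lookup w i ≡ sum (λ l → (lookup w l *F v l l) *F v i l)
      pivot-expansion w∈V i with proj₁ (spans _) w∈V
      ... | cs , refl = trans (lookup-linComb-columns cs v i) (sum-cong-≗ term)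
        where
        term : ∀ l → lookup cs l *F v i l ≡ (lookup (linComb cs (columns v)) l *F v l l) *F v i l
        term l with diag01 l
        ... | inj₁ vll≡0 = trans (zeroʳ′ _ (column-vanishes vll≡0)) (sym (zeroʳ′ _ (column-vanishes vll≡0)))
        ... | inj₂ vll≡1 = cong (_*F v i l)
          (sym (trans (cong₂ _*F_ (linComb-at-pivot cs vll≡1) vll≡1) (*-identityʳ _)))

      τ-dim : ∀ z → (∀ i → v i i ≡ bit (lookup z i)) → HasDim V (countTrue z)
      τ-dim z diag≡z = gather z (columns v) , independent , basis∈V , spanning
        where
        pivot = lookup (positions z)
        diag-true : ∀ {l} → lookup z l ≡ true → v l l ≡ 1F
        diag-true {l} zl = trans (diag≡z l) (cong bit zl)
        diag-false : ∀ {l} → lookup z l ≡ false → v l l ≡ 0F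
        diag-false {l} zl = trans (diag≡z l) (cong bit zl)

        independent : LinIndep (gather z (columns v))
        independent cs cs↦0 t = begin
          lookup cs t
            ≡⟨ lookup-scatter-positions 0F z cs t ⟨
          lookup (scatter 0F z cs) (pivot t)
            ≡⟨ linComb-at-pivot (scatter 0F z cs) (diag-true (lookup-positions z t)) ⟨
          lookup (linComb (scatter 0F z cs) (columns v)) (pivot t)
            ≡⟨ cong (λ w → lookup w (pivot t)) (trans (sym (linComb-gather z cs (columns v))) cs↦0) ⟩
          lookup zeroV (pivot t)
            ≡⟨ VecP.lookup-replicate (pivot t) 0F ⟩
          0F ∎
          where open ≡-Reasoning

        basis∈V : ∀ t → member V (lookup (gather z (columns v)) t)
        basis∈V t =
          subst (member V) (sym (VecP.lookup-map t (lookup (columns v)) (positions z))) (column∈ (pivot t))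

        spanning : ∀ w → member V w → InSpan (gather z (columns v)) w
        spanning w w∈V = gather z w , trans (linComb-gather z (gather z w) (columns v)) (lookup-ext entry)
          where
          coefficient : ∀ l → lookup (scatter 0F z (gather z w)) l ≡ lookup w l *F v l l
          coefficient l with lookup z l in zl
          ... | true = trans (lookup-scatter-gather 0F z w l zl)
                             (sym (trans (cong (_ *F_) (diag-true zl)) (*-identityʳ _)))
          ... | false = trans (lookup-scatter-false 0F z _ l zl) (sym (zeroʳ′ _ (diag-false zl)))
          entry : ∀ i → lookup (linComb (scatter 0F z (gather z w)) (columns v)) i ≡ lookup w i
          entry i = begin
            lookup (linComb (scatter 0F z (gather z w)) (columns v)) i
              ≡⟨ lookup-linComb-columns (scatter 0F z (gather z w)) v i ⟩
            sum (λ l → lookup (scatter 0F z (gather z w)) l *F v i l)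
              ≡⟨ sum-cong-≗ (λ l → cong (_*F v i l) (coefficient l)) ⟩
            sum (λ l → (lookup w l *F v l l) *F v i l)
              ≡⟨ pivot-expansion w∈V i ⟨
            lookup w i ∎
            where open ≡-Reasoning

    module _ {U V : Subspace} {u v : Matrix} (τU : IsTau U u) (τV : IsTau V v) (U⊆V : U ⊆S V) where

      column-expansion : ∀ i j → u i j ≡ sum (λ l → (u l j *F v l l) *F v i l)
      column-expansion i j = begin
        u i j                                         ≡⟨ lookup-columns u j i ⟨
        lookup (lookup (columns u) j) i               ≡⟨ pivot-expansion τV (U⊆V _ (column∈ τU j)) i ⟩
        sum (λ l → (lookup (lookup (columns u) j) l *F v l l) *F v i l)
          ≡⟨ sum-cong-≗ (λ l → cong (λ c → (c *F v l l) *F v i l) (lookup-columns u j l)) ⟩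
        sum (λ l → (u l j *F v l l) *F v i l)         ∎
        where open ≡-Reasoning

      expansion-term-vanishes : ∀ {i j l} → l ≢ j → (v l l ≡ 1F → u l l ≡ 1F) →
        (u l j *F v l l) *F v i l ≡ 0F
      expansion-term-vanishes {l = l} l≢j pivot⇒pivot with IsTau.diag01 τV l
      ... | inj₁ vll≡0 = zeroˡ′ _ (zeroʳ′ _ vll≡0)
      ... | inj₂ vll≡1 = zeroˡ′ _ (zeroˡ′ _ (pivotRow-vanishes τU (pivot⇒pivot vll≡1) l≢j))

      τ-unique : (∀ i → u i i ≡ v i i) → ∀ i j → u i j ≡ v i j
      τ-unique diag≡ i j with IsTau.diag01 τV j
      ... | inj₁ vjj≡0 = trans (column-vanishes τU (trans (diag≡ j) vjj≡0)) (sym (column-vanishes τV vjj≡0))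
      ... | inj₂ vjj≡1 = begin
        u i j                                  ≡⟨ column-expansion i j ⟩
        sum (λ l → (u l j *F v l l) *F v i l)
          ≡⟨ sum-single (λ l → (u l j *F v l l) *F v i l) j
               (λ l l≢j → expansion-term-vanishes l≢j (trans (diag≡ l))) ⟩
        (u j j *F v j j) *F v i j
          ≡⟨ cong₂ (λ a b → (a *F b) *F v i j) (trans (diag≡ j) vjj≡1) vjj≡1 ⟩
        (1F *F 1F) *F v i j                    ≡⟨ cong (_*F v i j) (*-identityˡ 1F) ⟩
        1F *F v i j                            ≡⟨ *-identityˡ _ ⟩
        v i j                                  ∎
        where open ≡-Reasoning

    countIs-parametrization : ∀ {A : Set} {P : Subspace → Set} (f : A → Subspace) {L : List A} →
      (∀ a → a ∈ L) → Unique L → (∀ {a b} → f a ≐ f b → a ≡ b) →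
      (∀ a → P (f a)) → (∀ U → P U → ∃ λ a → U ≐ f a) → CountIs P (length L)
    countIs-parametrization f {L} ∈L L! f-injective P∘f onto =
      List.map f L , ListP.length-map f L , AllP.map⁺ (All.universal P∘f L) ,
      AllPairsP.map⁺ (AllPairs.map (_∘ f-injective) L!) , complete
      where
      complete : ∀ U → _ → Any (U ≐_) (List.map f L)
      complete U PU with onto U PU
      ... | a , U≐fa = AnyP.map⁺ (Any.map (λ { refl → U≐fa }) (∈L a))

    module DeletePivot (x y : Vec Bool N) (k : Fin N)
      (x≈y : ∀ j → j ≢ k → lookup x j ≡ lookup y j) (xk : lookup x k ≡ true) (yk : lookup y k ≡ false)
      {V : Subspace} {v : Matrix} (τV : IsTau V v) (diag-v : ∀ i → v i i ≡ bit (lookup x i)) where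
      open IsTau τV using (upper; offDiag; diag01)

      free : Vec Bool N
      free = tabulate λ j → (toℕ k <ᵇ toℕ j) ∧ lookup x j

      lookup-free : ∀ j → lookup free j ≡ (toℕ k <ᵇ toℕ j) ∧ lookup x j
      lookup-free j = VecP.lookup∘tabulate _ j

      free-true : ∀ {j} → lookup free j ≡ true → toℕ k < toℕ j × lookup x j ≡ true
      free-true {j} fj with Equivalence.to T-∧ (subst T (lookup-free j) (Equivalence.from T-≡ fj))
      ... | k<ᵇj , xj = NatP.<ᵇ⇒< (toℕ k) (toℕ j) k<ᵇj , Equivalence.to T-≡ xj

      free-false : ∀ {j} → lookup free j ≡ false → lookup x j ≡ true → ¬ toℕ k < toℕ j
      free-false {j} fj xj k<j
        with () ← trans (sym fj) (trans (lookup-free j) (cong₂ _∧_ (Equivalence.to T-≡ (NatP.<⇒<ᵇ k<j)) xj))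

      Admissible : Vec Carrier N → Set
      Admissible a = ∀ j → lookup free j ≡ false → lookup a j ≡ 0F

      coverMatrix : Vec Carrier N → Matrix
      coverMatrix a i j with j ≟ k
      ... | yes _ = 0F
      ... | no _ = v i j +F lookup a j *F v i k

      cover : Vec Carrier N → Subspace
      cover a = span (columns (coverMatrix a))

      coverMatrix-k : ∀ a i {j} → j ≡ k → coverMatrix a i j ≡ 0F
      coverMatrix-k a i {j} j≡k with j ≟ k
      ... | yes _ = refl
      ... | no j≢k = ⊥-elim (j≢k j≡k)

      coverMatrix-≢ : ∀ a i {j} → j ≢ k → coverMatrix a i j ≡ v i j +F lookup a j *F v i k
      coverMatrix-≢ a i {j} j≢k with j ≟ k
      ... | yes j≡k = ⊥-elim (j≢k j≡k)
      ... | no _ = refl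

      ≡k⊎≢k : ∀ i → i ≡ k ⊎ i ≢ k
      ≡k⊎≢k i with i ≟ k
      ... | yes i≡k = inj₁ i≡k
      ... | no i≢k = inj₂ i≢k

      diag-true : ∀ {i} → lookup x i ≡ true → v i i ≡ 1F
      diag-true {i} xi = trans (diag-v i) (cong bit xi)

      diag-false : ∀ {i} → lookup x i ≡ false → v i i ≡ 0F
      diag-false {i} xi = trans (diag-v i) (cong bit xi)

      module _ (a : Vec Carrier N) (adm : Admissible a) where

        correction-vanishes : ∀ {i j} → (toℕ k < toℕ j → lookup x j ≡ true → v i k ≡ 0F) →
          lookup a j *F v i k ≡ 0F
        correction-vanishes {i} {j} vanish with lookup free j in fj
        ... | false = zeroˡ′ _ (adm j fj)
        ... | true = let k<j , xj = free-true fj in zeroʳ′ _ (vanish k<j xj)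

        coverMatrix-uncorrected : ∀ {i j} → j ≢ k → (toℕ k < toℕ j → lookup x j ≡ true → v i k ≡ 0F) →
          coverMatrix a i j ≡ v i j
        coverMatrix-uncorrected {i} {j} j≢k vanish =
          trans (coverMatrix-≢ a i j≢k) (trans (cong (v i j +F_) (correction-vanishes vanish)) (+-identityʳ _))

        coverMatrix-diag : ∀ {i} → i ≢ k → coverMatrix a i i ≡ v i i
        coverMatrix-diag i≢k = coverMatrix-uncorrected i≢k λ _ xi → pivotRow-vanishes τV (diag-true xi) i≢k

        coverMatrix-diag-y : ∀ i → coverMatrix a i i ≡ bit (lookup y i)
        coverMatrix-diag-y i with ≡k⊎≢k i
        ... | inj₁ refl = trans (coverMatrix-k a k refl) (cong bit (sym yk))
        ... | inj₂ i≢k = trans (coverMatrix-diag i≢k) (trans (diag-v i) (cong bit (x≈y i i≢k)))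

        coverMatrix-upper : ∀ i j → toℕ j < toℕ i → coverMatrix a i j ≡ 0F
        coverMatrix-upper i j j<i with ≡k⊎≢k j
        ... | inj₁ j≡k = coverMatrix-k a i j≡k
        ... | inj₂ j≢k =
          trans (coverMatrix-uncorrected j≢k (λ k<j _ → upper i k (NatP.<-trans k<j j<i))) (upper i j j<i)

        coverMatrix-nonPivot : ∀ {i} → (i ≢ k → v i i ≡ 0F) → coverMatrix a i i ≡ 0F
        coverMatrix-nonPivot {i} vii≡0 with ≡k⊎≢k i
        ... | inj₁ i≡k = coverMatrix-k a i i≡k
        ... | inj₂ i≢k = trans (coverMatrix-diag i≢k) (vii≡0 i≢k)

        coverMatrix-offDiag : ∀ i j → i ≢ j → coverMatrix a i j ≢ 0F →
          coverMatrix a i i ≡ 0F × coverMatrix a j j ≡ 1F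
        coverMatrix-offDiag i j i≢j wij≢0 with ≡k⊎≢k j
        ... | inj₁ j≡k = ⊥-elim (wij≢0 (coverMatrix-k a i j≡k))
        ... | inj₂ j≢k with v i j ≟F 0F
        ...   | no vij≢0 = let vii≡0 , vjj≡1 = offDiag i j i≢j vij≢0
                           in coverMatrix-nonPivot (λ _ → vii≡0) , trans (coverMatrix-diag j≢k) vjj≡1
        ...   | yes vij≡0 = coverMatrix-nonPivot (λ i≢k → proj₁ (offDiag i k i≢k vik≢0)) , jPivot
          where
          correction≢0 : lookup a j *F v i k ≢ 0F
          correction≢0 c≡0 = wij≢0 (trans (coverMatrix-≢ a i j≢k)
            (trans (cong₂ _+F_ vij≡0 c≡0) (+-identityˡ 0F)))
          vik≢0 : v i k ≢ 0F
          vik≢0 = correction≢0 ∘ zeroʳ′ _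
          jPivot : coverMatrix a j j ≡ 1F
          jPivot with lookup free j in fj
          ... | false = ⊥-elim (correction≢0 (zeroˡ′ _ (adm j fj)))
          ... | true = trans (coverMatrix-diag j≢k) (diag-true (proj₂ (free-true fj)))

        τ-cover : IsTau (cover a) (coverMatrix a)
        τ-cover = record
          { upper = coverMatrix-upper
          ; spans = λ _ → (λ w∈ → w∈) , (λ w∈ → w∈)
          ; diag01 = λ i → subst (λ c → c ≡ 0F ⊎ c ≡ 1F) (sym (coverMatrix-diag-y i)) (bit01 (lookup y i))
          ; offDiag = coverMatrix-offDiag
          }

      coverMatrix-row-k : ∀ a {j} → j ≢ k → coverMatrix a k j ≡ lookup a j
      coverMatrix-row-k a {j} j≢k = begin
        coverMatrix a k j              ≡⟨ coverMatrix-≢ a k j≢k ⟩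
        v k j +F lookup a j *F v k k
          ≡⟨ cong₂ (λ b c → b +F lookup a j *F c) (pivotRow-vanishes τV vkk≡1 (j≢k ∘ sym)) vkk≡1 ⟩
        0F +F lookup a j *F 1F         ≡⟨ trans (+-identityˡ _) (*-identityʳ _) ⟩
        lookup a j                     ∎
        where
        open ≡-Reasoning
        vkk≡1 = diag-true xk

      cover⊆V : ∀ a → cover a ⊆S V
      cover⊆V a w (cs , refl) = linComb∈ V cs column∈V
        where
        column∈V : ∀ j → member V (lookup (columns (coverMatrix a)) j)
        column∈V j with ≡k⊎≢k j
        ... | inj₁ j≡k = subst (member V) (sym (lookup-ext column≡0)) (zero∈ V)
          where
          column≡0 : ∀ i → lookup (lookup (columns (coverMatrix a)) j) i ≡ lookup zeroV i
          column≡0 i =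
            trans (lookup-columns _ j i) (trans (coverMatrix-k a i j≡k) (sym (VecP.lookup-replicate i 0F)))
        ... | inj₂ j≢k = subst (member V) (sym (lookup-ext column≡))
                          (+∈ V (column∈ τV j) (·∈ V (lookup a j) (column∈ τV k)))
          where
          column≡ : ∀ i → lookup (lookup (columns (coverMatrix a)) j) i
                          ≡ lookup (lookup (columns v) j +V (lookup a j ·V lookup (columns v) k)) i
          column≡ i = begin
            lookup (lookup (columns (coverMatrix a)) j) i  ≡⟨ lookup-columns _ j i ⟩
            coverMatrix a i j                              ≡⟨ coverMatrix-≢ a i j≢k ⟩
            v i j +F lookup a j *F v i k
              ≡⟨ cong₂ (λ b c → b +F lookup a j *F c) (lookup-columns v j i) (lookup-columns v k i) ⟨
            lookup (lookup (columns v) j) i +F lookup a j *F lookup (lookup (columns v) k) i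
              ≡⟨ cong (_ +F_) (VecP.lookup-map i (lookup a j *F_) (lookup (columns v) k)) ⟨
            lookup (lookup (columns v) j) i +F lookup (lookup a j ·V lookup (columns v) k) i
              ≡⟨ VecP.lookup-zipWith _+F_ i (lookup (columns v) j) _ ⟨
            lookup (lookup (columns v) j +V (lookup a j ·V lookup (columns v) k)) i ∎
            where open ≡-Reasoning

      admissible-k : ∀ a → Admissible a → lookup a k ≡ 0F
      admissible-k a adm with lookup free k in fk
      ... | false = adm k fk
      ... | true = ⊥-elim (NatP.<-irrefl refl (proj₁ (free-true fk)))

      cover-covered : ∀ a → Admissible a → Covers V (cover a) × TauDiag (cover a) y
      cover-covered a adm =
        (cover⊆V a , countTrue y , τ-dim (τ-cover a adm) y (coverMatrix-diag-y a adm)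
                   , subst (HasDim V) (countTrue-drop x y k x≈y xk yk) (τ-dim τV x diag-v))
        , (coverMatrix a , τ-cover a adm , coverMatrix-diag-y a adm)

      cover-injective : ∀ a a' → Admissible a → Admissible a' → cover a ≐ cover a' → a ≡ a'
      cover-injective a a' adm adm' (a⊆a' , _) = lookup-ext entry
        where
        entry : ∀ j → lookup a j ≡ lookup a' j
        entry j with ≡k⊎≢k j
        ... | inj₁ refl = trans (admissible-k a adm) (sym (admissible-k a' adm'))
        ... | inj₂ j≢k = begin
          lookup a j         ≡⟨ coverMatrix-row-k a j≢k ⟨
          coverMatrix a k j  ≡⟨ τ-unique (τ-cover a adm) (τ-cover a' adm') a⊆a' sameDiagonal k j ⟩
          coverMatrix a' k j ≡⟨ coverMatrix-row-k a' j≢k ⟩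
          lookup a' j        ∎
          where
          open ≡-Reasoning
          sameDiagonal : ∀ i → coverMatrix a i i ≡ coverMatrix a' i i
          sameDiagonal i = trans (coverMatrix-diag-y a adm i) (sym (coverMatrix-diag-y a' adm' i))

      module _ {U : Subspace} {u : Matrix} (τU : IsTau U u) (U⊆V : U ⊆S V)
               (diag-u : ∀ i → u i i ≡ bit (lookup y i)) where

        diag-u≡v : ∀ {i} → i ≢ k → u i i ≡ v i i
        diag-u≡v {i} i≢k = trans (diag-u i) (trans (cong bit (sym (x≈y i i≢k))) (sym (diag-v i)))

        rowK : Vec Carrier N
        rowK = tabulate (u k)

        rowK-admissible : Admissible rowK
        rowK-admissible j fj = trans (VecP.lookup∘tabulate (u k) j) (ukj≡0 (≡k⊎≢k j))
          where
          ukj≡0 : j ≡ k ⊎ j ≢ k → u k j ≡ 0F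
          ukj≡0 (inj₁ refl) = trans (diag-u k) (cong bit yk)
          ukj≡0 (inj₂ j≢k) with lookup x j in xj | NatP.<-cmp (toℕ j) (toℕ k)
          ... | false | _ = column-vanishes τU (trans (diag-u≡v j≢k) (diag-false xj))
          ... | true | tri< j<k _ _ = IsTau.upper τU k j j<k
          ... | true | tri≈ _ j≡k _ = ⊥-elim (j≢k (toℕ-injective j≡k))
          ... | true | tri> _ _ k<j = ⊥-elim (free-false fj xj k<j)

        diagonal-term : ∀ i {j} → j ≢ k → (u j j *F v j j) *F v i j ≡ v i j
        diagonal-term i {j} j≢k with diag01 j
        ... | inj₁ vjj≡0 = trans (zeroˡ′ _ (zeroʳ′ _ vjj≡0)) (sym (column-vanishes τV vjj≡0))
        ... | inj₂ vjj≡1 = begin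
          (u j j *F v j j) *F v i j
            ≡⟨ cong₂ (λ b c → (b *F c) *F v i j) (trans (diag-u≡v j≢k) vjj≡1) vjj≡1 ⟩
          (1F *F 1F) *F v i j        ≡⟨ trans (cong (_*F v i j) (*-identityˡ 1F)) (*-identityˡ _) ⟩
          v i j                      ∎
          where open ≡-Reasoning

        u≡coverMatrix : ∀ i j → u i j ≡ coverMatrix rowK i j
        u≡coverMatrix i j with ≡k⊎≢k j
        ... | inj₁ j≡k = trans (column-vanishes τU (trans (diag-u j) (cong bit (trans (cong (lookup y) j≡k) yk))))
                           (sym (coverMatrix-k rowK i j≡k))
        ... | inj₂ j≢k = begin
          u i j                                   ≡⟨ column-expansion τU τV U⊆V i j ⟩
          sum (λ l → (u l j *F v l l) *F v i l)   ≡⟨ sum-pair (λ l → (u l j *F v l l) *F v i l) j≢k vanish ⟩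
          (u j j *F v j j) *F v i j +F (u k j *F v k k) *F v i k
            ≡⟨ cong₂ _+F_ (diagonal-term i j≢k) (cong (_*F v i k) pivotTerm) ⟩
          v i j +F lookup rowK j *F v i k         ≡⟨ coverMatrix-≢ rowK i j≢k ⟨
          coverMatrix rowK i j                    ∎
          where
          open ≡-Reasoning
          vanish : ∀ l → l ≢ j → l ≢ k → (u l j *F v l l) *F v i l ≡ 0F
          vanish l l≢j l≢k = expansion-term-vanishes τU τV U⊆V l≢j (trans (diag-u≡v l≢k))
          pivotTerm : u k j *F v k k ≡ lookup rowK j
          pivotTerm = trans (cong (u k j *F_) (diag-true xk))
                        (trans (*-identityʳ _) (sym (VecP.lookup∘tabulate (u k) j)))

        U≐cover : U ≐ cover rowK
        U≐cover = (λ w w∈U → subst (λ vs → InSpan vs w) columns≡ (proj₁ (IsTau.spans τU w) w∈U))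
                , (λ w w∈ → proj₂ (IsTau.spans τU w) (subst (λ vs → InSpan vs w) (sym columns≡) w∈))
          where
          columns≡ : columns u ≡ columns (coverMatrix rowK)
          columns≡ = VecP.tabulate-cong λ j → VecP.tabulate-cong λ i → u≡coverMatrix i j

      cover-complete : ∀ U → Covers V U × TauDiag U y → ∃ λ a → Admissible a × U ≐ cover a
      cover-complete U ((U⊆V , _) , u , τU , diag-u) =
        rowK τU U⊆V diag-u , rowK-admissible τU U⊆V diag-u , U≐cover τU U⊆V diag-u

mainTheorem2 : ∀ {q : ℕ} (K : FiniteField q) (N : ℕ) (x y : Vec Bool N) (k : Fin N)
    → hamming x y ≡ 1 → lookup x k ≡ true → lookup y k ≡ false
    → (V : Linear.Subspace K N) → Linear.TauDiag K N V x
    → Linear.CountIs K N (λ U → Linear.Covers K N V U × Linear.TauDiag K N U y) (q ^ sumAfter k x)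
mainTheorem2 {q} K N x y k h xk yk V (v , τV , diag-v) =
  subst (CountIs _) count
    (countIs-parametrization K N (cover ∘ scatter 0F free) (∈-vectors (∈-elements K))
      (vectors-unique (elements-unique K) _) injective (cover-covered _ ∘ admissible) onto)
  where
  open FiniteField K using (0F)
  open Linear K N using (CountIs; Covers; TauDiag; _≐_)
  open DeletePivot K N x y k (hamming≡1⇒agree x y k h xk yk) xk yk τV diag-v

  admissible : ∀ c → Admissible (scatter 0F free c)
  admissible c j = lookup-scatter-false 0F free c j

  injective : ∀ {c c'} → cover (scatter 0F free c) ≐ cover (scatter 0F free c') → c ≡ c'
  injective eq = scatter-injective 0F free (cover-injective _ _ (admissible _) (admissible _) eq)

  onto : ∀ U → Covers V U × TauDiag U y → ∃ λ c → U ≐ cover (scatter 0F free c)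
  onto U P with cover-complete U P
  ... | a , adm , U≐a = gather free a , subst (λ a → U ≐ cover a) (sym (scatter-gather 0F free adm)) U≐a

  count : length (vectors (elements K) (countTrue free)) ≡ q ^ sumAfter k x
  count = trans (length-vectors (elements K) (countTrue free))
    (cong₂ _^_ (length-elements K) (countTrue-tabulate λ j → (toℕ k <ᵇ toℕ j) ∧ lookup x j))
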